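{- Let $q,t\in\mathbb{C}$. (i) For any integer $n\ge2$, $$\det[q^{|j-k|}+t]_{1\le j,k\le n}=(1-q)^{n-1}(1+q)^{n-2}\big((n(1-q)+2q)t+q+1\big).$$ (ii) For any positive integer $n$, $$\det[q^{|j-k|}-q^j-q^k+1]_{1\le j,k\le n}=(1-q^2)^n+n(1+q)^{n-1}(1-q)^{n+1}.$$
   Context: The convention $0^0=1$ is used (so $q^0=1$ even when $q=0$). -}

module Defs where

open import Level using (Level)
open import Algebra.Bundles using (CommutativeRing)
open import Data.Nat.Base using (ℕ; zero; suc)
open import Data.Fin.Base using (Fin; zero; suc; toℕ; punchIn)

module Determinant {c ℓ : Level} (R : CommutativeRing c ℓ) where
  open CommutativeRing R using (Carrier; _+_; _*_; -_; 0#; 1#)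

  ∑ : ∀ {n} → (Fin n → Carrier) → Carrier
  ∑ {zero}  f = 0#
  ∑ {suc n} f = f zero + ∑ (λ j → f (suc j))

  sgn : ℕ → Carrier
  sgn zero    = 1#
  sgn (suc j) = - sgn j

  minor : ∀ {n} → (Fin (suc n) → Fin (suc n) → Carrier) → Fin (suc n)
        → Fin n → Fin n → Carrier
  minor M j a b = M (suc a) (punchIn j b)

  det : ∀ n → (Fin n → Fin n → Carrier) → Carrier
  det zero    M = 1#
  det (suc n) M = ∑ (λ j → sgn (toℕ j) * (M zero j * det n (minor M j)))

module Submission where

-- Let P = [q^|j-k|].  Subtracting from each row the previous one leaves row 0 equal to
-- q^k + t and turns every other row into (1 - q) times a row free of t, so det (P + t)
-- is linear in t; a second round of row operations, an expansion along the first
-- column and an induction on a Hessenberg matrix evaluate both coefficients.  For (ii),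
-- subtracting multiples of row 0 shows that for any matrix P
--   det (P + t) = det P + t · det [P j k - P j 0 - P 0 k + P 0 0] (j, k ≥ 1),
-- so the determinant in (ii) is the coefficient of t in (i) at size n + 1.

open import Defs
open import Level using (Level)
import Algebra.Bundles
open import Algebra.Bundles using (CommutativeRing)
open import Data.Nat.Base as ℕ using (ℕ; zero; suc; s≤s; _≤_; _∸_; ∣_-_∣)
import Data.Nat.Properties as ℕ
open import Data.Fin.Base using (Fin; zero; suc; toℕ; punchIn; pinch; inject₁)
open import Data.Fin.Properties using (toℕ-inject₁)
open import Data.Integer.Base as ℤ using (ℤ; +_; -[1+_]; _⊖_)
import Data.Integer.Properties as ℤ
import Data.Maybe.Base as Maybe
open import Data.Product.Base using (_×_; _,_)
open import Function.Base using (_∘_)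
open import Relation.Nullary.Decidable using (dec⇒maybe)
import Relation.Binary.PropositionalEquality as ≡
import Relation.Binary.Reasoning.Setoid as SetoidReasoning
open import Algebra.Solver.Ring.AlmostCommutativeRing
  using (fromCommutativeRing; _-Raw-AlmostCommutative⟶_)
import Algebra.Solver.Ring
import Algebra.Definitions.RawSemiring as RS

-- The ring solver decides equality of normal forms through their coefficients, so an
-- abstract ring is handled with coefficients from ℤ, which maps into every ring.
module IntegerCoefficients {c ℓ : Level} (R : CommutativeRing c ℓ) where
  open CommutativeRing R
  open import Algebra.Properties.Ring ring
    using (-0#≈0#; -‿involutive; -‿+-comm; -‿distribˡ-*; -‿distribʳ-*)
  -- the optimised multiple satisfies 1 · x = x definitionally, so 𝟙 evaluates to 1#
  open import Algebra.Properties.Semiring.Mult.TCOptimised semiring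
    using (1+×; ×-homo-+; ×1-homo-*) renaming (_×_ to _·_)
  open SetoidReasoning setoid

  fromℤ : ℤ → Carrier
  fromℤ (+ n)      = n · 1#
  fromℤ (-[1+ n ]) = - (suc n · 1#)

  fromℤ-⊖ : ∀ m n → fromℤ (m ⊖ n) ≈ m · 1# - n · 1#
  fromℤ-⊖ m zero = begin
    m · 1#                             ≈⟨ +-identityʳ _ ⟨
    m · 1# + 0#                        ≈⟨ +-congˡ -0#≈0# ⟨
    m · 1# - 0#                        ∎
  fromℤ-⊖ zero (suc n) = sym (+-identityˡ _)
  fromℤ-⊖ (suc m) (suc n) = begin
    fromℤ (suc m ⊖ suc n)              ≡⟨ ≡.cong fromℤ (ℤ.[1+m]⊖[1+n]≡m⊖n m n) ⟩
    fromℤ (m ⊖ n)                      ≈⟨ fromℤ-⊖ m n ⟩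
    m · 1# - n · 1#                    ≈⟨ +-identityˡ _ ⟨
    0# + (m · 1# - n · 1#)             ≈⟨ +-congʳ (-‿inverseʳ 1#) ⟨
    (1# - 1#) + (m · 1# - n · 1#)      ≈⟨ +-assoc _ _ _ ⟩
    1# + (- 1# + (m · 1# - n · 1#))    ≈⟨ +-congˡ (+-assoc _ _ _) ⟨
    1# + ((- 1# + m · 1#) - n · 1#)    ≈⟨ +-congˡ (+-congʳ (+-comm _ _)) ⟩
    1# + ((m · 1# - 1#) - n · 1#)      ≈⟨ +-congˡ (+-assoc _ _ _) ⟩
    1# + (m · 1# + (- 1# - n · 1#))    ≈⟨ +-assoc _ _ _ ⟨
    (1# + m · 1#) + (- 1# - n · 1#)    ≈⟨ +-congˡ (-‿+-comm 1# (n · 1#)) ⟩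
    (1# + m · 1#) - (1# + n · 1#)      ≈⟨ +-cong (1+× m 1#) (-‿cong (1+× n 1#)) ⟨
    suc m · 1# - suc n · 1#            ∎

  fromℤ-+ : ∀ i j → fromℤ (i ℤ.+ j) ≈ fromℤ i + fromℤ j
  fromℤ-+ (+ m)    (+ n)    = ×-homo-+ 1# m n
  fromℤ-+ (+ m)    -[1+ n ] = fromℤ-⊖ m (suc n)
  fromℤ-+ -[1+ m ] (+ n)    = trans (fromℤ-⊖ n (suc m)) (+-comm _ _)
  fromℤ-+ -[1+ m ] -[1+ n ] = begin
    - (suc (suc (m ℕ.+ n)) · 1#)       ≡⟨ ≡.cong (λ k → - (suc k · 1#)) (ℕ.+-suc m n) ⟨
    - ((suc m ℕ.+ suc n) · 1#)         ≈⟨ -‿cong (×-homo-+ 1# (suc m) (suc n)) ⟩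
    - (suc m · 1# + suc n · 1#)        ≈⟨ -‿+-comm _ _ ⟨
    - (suc m · 1#) - suc n · 1#        ∎

  fromℤ-neg : ∀ i → fromℤ (ℤ.- i) ≈ - fromℤ i
  fromℤ-neg (+ zero)  = sym -0#≈0#
  fromℤ-neg (+ suc n) = refl
  fromℤ-neg -[1+ n ]  = sym (-‿involutive _)

  fromℤ-*-pos : ∀ m j → fromℤ (+ m ℤ.* j) ≈ m · 1# * fromℤ j
  fromℤ-*-pos m (+ n) = begin
    fromℤ (+ m ℤ.* + n)                ≡⟨ ≡.cong fromℤ (ℤ.pos-* m n) ⟨
    (m ℕ.* n) · 1#                     ≈⟨ ×1-homo-* m n ⟩
    m · 1# * n · 1#                    ∎
  fromℤ-*-pos m -[1+ n ] = begin
    fromℤ (+ m ℤ.* -[1+ n ])           ≡⟨ ≡.cong fromℤ (ℤ.neg-distribʳ-* (+ m) (+ suc n)) ⟨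
    fromℤ (ℤ.- (+ m ℤ.* + suc n))      ≈⟨ fromℤ-neg (+ m ℤ.* + suc n) ⟩
    - fromℤ (+ m ℤ.* + suc n)          ≈⟨ -‿cong (fromℤ-*-pos m (+ suc n)) ⟩
    - (m · 1# * suc n · 1#)            ≈⟨ -‿distribʳ-* _ _ ⟩
    m · 1# * - (suc n · 1#)            ∎

  fromℤ-* : ∀ i j → fromℤ (i ℤ.* j) ≈ fromℤ i * fromℤ j
  fromℤ-* (+ m) j = fromℤ-*-pos m j
  fromℤ-* -[1+ m ] j = begin
    fromℤ (-[1+ m ] ℤ.* j)             ≡⟨ ≡.cong fromℤ (ℤ.neg-distribˡ-* (+ suc m) j) ⟨
    fromℤ (ℤ.- (+ suc m ℤ.* j))        ≈⟨ fromℤ-neg (+ suc m ℤ.* j) ⟩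
    - fromℤ (+ suc m ℤ.* j)            ≈⟨ -‿cong (fromℤ-*-pos (suc m) j) ⟩
    - (suc m · 1# * fromℤ j)           ≈⟨ -‿distribˡ-* _ _ ⟩
    - (suc m · 1#) * fromℤ j           ∎

  homomorphism : ℤ.+-*-rawRing -Raw-AlmostCommutative⟶ fromCommutativeRing R
  homomorphism = record
    { ⟦_⟧ = fromℤ ; +-homo = fromℤ-+ ; *-homo = fromℤ-* ; -‿homo = fromℤ-neg
    ; 0-homo = refl ; 1-homo = refl }

  open Algebra.Solver.Ring ℤ.+-*-rawRing (fromCommutativeRing R) homomorphism
    (λ i j → Maybe.map (reflexive ∘ ≡.cong fromℤ) (dec⇒maybe (i ℤ.≟ j)))
    public using (solve; Polynomial; con; _:+_; _:-_; _:*_; :-_; _:=_)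

  𝟘 𝟙 : ∀ {m} → Polynomial m
  𝟘 = con (+ 0)
  𝟙 = con (+ 1)

punchIn-punchIn-pinch : ∀ {m} (j : Fin (suc m)) (b : Fin m) →
  punchIn (punchIn j b) (pinch b j) ≡.≡ j
punchIn-punchIn-pinch zero    zero    = ≡.refl
punchIn-punchIn-pinch zero    (suc b) = ≡.refl
punchIn-punchIn-pinch (suc j) zero    = ≡.refl
punchIn-punchIn-pinch (suc j) (suc b) = ≡.cong suc (punchIn-punchIn-pinch j b)

punchIn-punchIn-pinch-comm : ∀ {m} (j : Fin (suc (suc m))) (b : Fin (suc m)) (y : Fin m) →
  punchIn (punchIn j b) (punchIn (pinch b j) y) ≡.≡ punchIn j (punchIn b y)
punchIn-punchIn-pinch-comm zero    zero    y       = ≡.refl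
punchIn-punchIn-pinch-comm zero    (suc b) y       = ≡.refl
punchIn-punchIn-pinch-comm (suc j) zero    y       = ≡.refl
punchIn-punchIn-pinch-comm (suc j) (suc b) zero    = ≡.refl
punchIn-punchIn-pinch-comm (suc j) (suc b) (suc y) = ≡.cong suc (punchIn-punchIn-pinch-comm j b y)

module DeterminantProperties {c ℓ : Level} (R : CommutativeRing c ℓ) where
  open CommutativeRing R hiding (zero)
  open RS (Algebra.Bundles.Semiring.rawSemiring semiring) using (_^_)
  open Determinant R
  open import Algebra.Properties.Ring ring using (+-inverseʳ-unique; -‿involutive)
  open IntegerCoefficients R
  open SetoidReasoning setoid

  Vector : ℕ → Set c
  Vector n = Fin n → Carrier

  Matrix : ℕ → Set c
  Matrix n = Fin n → Vector n

  infix  4 _≋_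
  infixl 6 _+ᵥ_
  infixr 7 _*ᵥ_

  _≋_ : ∀ {n} → Vector n → Vector n → Set ℓ
  u ≋ v = ∀ k → u k ≈ v k

  _+ᵥ_ : ∀ {n} → Vector n → Vector n → Vector n
  (u +ᵥ v) k = u k + v k

  _*ᵥ_ : ∀ {n} → Carrier → Vector n → Vector n
  (x *ᵥ u) k = x * u k

  setRow₀ : ∀ {n} → Vector (suc n) → Matrix (suc n) → Matrix (suc n)
  setRow₀ u M zero    = u
  setRow₀ u M (suc i) = M (suc i)

  setRows₀₁ : ∀ {n} → Vector (suc (suc n)) → Vector (suc (suc n)) →
              Matrix (suc (suc n)) → Matrix (suc (suc n))
  setRows₀₁ u v M zero          = u
  setRows₀₁ u v M (suc zero)    = v
  setRows₀₁ u v M (suc (suc i)) = M (suc (suc i))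

  ∑-cong : ∀ {n} {f g : Vector n} → f ≋ g → ∑ f ≈ ∑ g
  ∑-cong {zero}  f≋g = refl
  ∑-cong {suc n} f≋g = +-cong (f≋g zero) (∑-cong (λ i → f≋g (suc i)))

  ∑-zero : ∀ {n} {f : Vector n} → (∀ i → f i ≈ 0#) → ∑ f ≈ 0#
  ∑-zero {zero}  f≈0 = refl
  ∑-zero {suc n} f≈0 = trans (+-cong (f≈0 zero) (∑-zero (λ i → f≈0 (suc i)))) (+-identityˡ 0#)

  ∑-distrib-+ : ∀ {n} (f g : Vector n) → ∑ (f +ᵥ g) ≈ ∑ f + ∑ g
  ∑-distrib-+ {zero}  f g = sym (+-identityˡ 0#)
  ∑-distrib-+ {suc n} f g = trans (+-congˡ (∑-distrib-+ (λ i → f (suc i)) (λ i → g (suc i))))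
    (solve 4 (λ a b c d → (a :+ b) :+ (c :+ d) := (a :+ c) :+ (b :+ d)) refl _ _ _ _)

  *-distribˡ-∑ : ∀ {n} x (f : Vector n) → x * ∑ f ≈ ∑ (x *ᵥ f)
  *-distribˡ-∑ {zero}  x f = zeroʳ x
  *-distribˡ-∑ {suc n} x f = trans (distribˡ _ _ _) (+-congˡ (*-distribˡ-∑ x (λ i → f (suc i))))

  term-cong : ∀ {n} (j : Fin n) {a b d e} → a ≈ b → d ≈ e → sgn (toℕ j) * (a * d) ≈ sgn (toℕ j) * (b * e)
  term-cong j a≈b d≈e = *-congˡ (*-cong a≈b d≈e)

  det-expansion-cong : ∀ n {M N : Matrix (suc n)} → M zero ≋ N zero →
    (∀ j → det n (minor M j) ≈ det n (minor N j)) → det (suc n) M ≈ det (suc n) N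
  det-expansion-cong n row₀ minors = ∑-cong (λ j → term-cong j (row₀ j) (minors j))

  det-cong : ∀ n {M N : Matrix n} → (∀ i → M i ≋ N i) → det n M ≈ det n N
  det-cong zero    M≋N = refl
  det-cong (suc n) {M} {N} M≋N = det-expansion-cong n {M} {N} (M≋N zero)
    (λ j → det-cong n (λ i k → M≋N (suc i) (punchIn j k)))

  det-linear-row₀ : ∀ n {P M N : Matrix (suc n)} x →
    P zero ≋ M zero +ᵥ x *ᵥ N zero →
    (∀ i → P (suc i) ≋ M (suc i)) → (∀ i → N (suc i) ≋ M (suc i)) →
    det (suc n) P ≈ det (suc n) M + x * det (suc n) N
  det-linear-row₀ n {P} {M} {N} x row₀ P≋M N≋M = begin
    det (suc n) P
      ≈⟨ ∑-cong (λ j → term-cong j (row₀ j) (det-cong n (λ i k → P≋M i (punchIn j k)))) ⟩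
    ∑ (λ j → sgn (toℕ j) * ((M zero j + x * N zero j) * det n (minor M j)))
      ≈⟨ ∑-cong (λ j → solve 5 (λ s m x n d → s :* ((m :+ x :* n) :* d) := s :* (m :* d) :+ x :* (s :* (n :* d)))
                         refl (sgn (toℕ j)) (M zero j) x (N zero j) (det n (minor M j))) ⟩
    ∑ (termM +ᵥ x *ᵥ termN)
      ≈⟨ ∑-distrib-+ termM (x *ᵥ termN) ⟩
    det (suc n) M + ∑ (x *ᵥ termN)
      ≈⟨ +-congˡ (*-distribˡ-∑ x termN) ⟨
    det (suc n) M + x * ∑ termN
      ≈⟨ +-congˡ (*-congˡ (∑-cong (λ j →
           term-cong j (refl {N zero j}) (det-cong n (λ i k → sym (N≋M i (punchIn j k))))))) ⟩
    det (suc n) M + x * det (suc n) N ∎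
    where
    termM termN : Vector (suc n)
    termM j = sgn (toℕ j) * (M zero j * det n (minor M j))
    termN j = sgn (toℕ j) * (N zero j * det n (minor M j))

  det-linear-row₁ : ∀ n {P M N : Matrix (suc (suc n))} x →
    P zero ≋ M zero → N zero ≋ M zero →
    P (suc zero) ≋ M (suc zero) +ᵥ x *ᵥ N (suc zero) →
    (∀ i → P (suc (suc i)) ≋ M (suc (suc i))) → (∀ i → N (suc (suc i)) ≋ M (suc (suc i))) →
    det (suc (suc n)) P ≈ det (suc (suc n)) M + x * det (suc (suc n)) N
  det-linear-row₁ n {P} {M} {N} x P₀≋M₀ N₀≋M₀ row₁ P≋M N≋M = begin
    det (suc (suc n)) P
      ≈⟨ ∑-cong (λ j → term-cong j (P₀≋M₀ j) (det-linear-row₀ n {minor P j} {minor M j} {minor N j} x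
           (λ k → row₁ (punchIn j k)) (λ i k → P≋M i (punchIn j k)) (λ i k → N≋M i (punchIn j k)))) ⟩
    ∑ (λ j → sgn (toℕ j) * (M zero j * (det (suc n) (minor M j) + x * det (suc n) (minor N j))))
      ≈⟨ ∑-cong (λ j → solve 5 (λ s m d x e → s :* (m :* (d :+ x :* e)) := s :* (m :* d) :+ x :* (s :* (m :* e)))
                         refl (sgn (toℕ j)) (M zero j) (det (suc n) (minor M j)) x (det (suc n) (minor N j))) ⟩
    ∑ (termM +ᵥ x *ᵥ termN)
      ≈⟨ ∑-distrib-+ termM (x *ᵥ termN) ⟩
    det (suc (suc n)) M + ∑ (x *ᵥ termN)
      ≈⟨ +-congˡ (*-distribˡ-∑ x termN) ⟨
    det (suc (suc n)) M + x * ∑ termN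
      ≈⟨ +-congˡ (*-congˡ (∑-cong (λ j → term-cong j (sym (N₀≋M₀ j)) (refl {det (suc n) (minor N j)})))) ⟩
    det (suc (suc n)) M + x * det (suc (suc n)) N ∎
    where
    termM termN : Vector (suc (suc n))
    termM j = sgn (toℕ j) * (M zero j * det (suc n) (minor M j))
    termN j = sgn (toℕ j) * (M zero j * det (suc n) (minor N j))

  ∑∑-cancel : ∀ m (f : Fin (suc m) → Fin m → Carrier) →
    (∀ j b → f j b + f (punchIn j b) (pinch b j) ≈ 0#) → ∑ (λ j → ∑ (f j)) ≈ 0#
  ∑∑-cancel zero    f cancels = +-identityˡ 0#
  ∑∑-cancel (suc m) f cancels = begin
    ∑ (f zero) + ∑ (λ j → f (suc j) zero + ∑ (λ b → f (suc j) (suc b)))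
      ≈⟨ +-congˡ (∑-distrib-+ (λ j → f (suc j) zero) (λ j → ∑ (λ b → f (suc j) (suc b)))) ⟩
    ∑ (f zero) + (∑ (λ j → f (suc j) zero) + ∑ (λ j → ∑ (λ b → f (suc j) (suc b))))
      ≈⟨ +-assoc _ _ _ ⟨
    (∑ (f zero) + ∑ (λ j → f (suc j) zero)) + ∑ (λ j → ∑ (λ b → f (suc j) (suc b)))
      ≈⟨ +-cong (trans (sym (∑-distrib-+ (f zero) (λ j → f (suc j) zero))) (∑-zero (cancels zero)))
                (∑∑-cancel m (λ j b → f (suc j) (suc b)) (λ j b → cancels (suc j) (suc b))) ⟩
    0# + 0#  ≈⟨ +-identityˡ 0# ⟩
    0# ∎

  sgn-punchIn-pinch : ∀ {m} (j : Fin (suc m)) (b : Fin m) →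
    sgn (toℕ (punchIn j b)) * sgn (toℕ (pinch b j)) ≈ - (sgn (toℕ j) * sgn (toℕ b))
  sgn-punchIn-pinch zero    zero    = solve 0 ((:- 𝟙) :* 𝟙 := :- (𝟙 :* 𝟙)) refl
  sgn-punchIn-pinch zero    (suc b) = solve 1 (λ s → (:- :- s) :* 𝟙 := :- (𝟙 :* :- s)) refl (sgn (toℕ b))
  sgn-punchIn-pinch (suc j) zero    = solve 1 (λ s → 𝟙 :* s := :- (:- s :* 𝟙)) refl (sgn (toℕ j))
  sgn-punchIn-pinch (suc j) (suc b) = begin
    - sgn (toℕ (punchIn j b)) * - sgn (toℕ (pinch b j)) ≈⟨ solve 2 (λ x y → :- x :* :- y := x :* y) refl _ _ ⟩
    sgn (toℕ (punchIn j b)) * sgn (toℕ (pinch b j))     ≈⟨ sgn-punchIn-pinch j b ⟩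
    - (sgn (toℕ j) * sgn (toℕ b))                       ≈⟨ solve 2 (λ x y → :- (x :* y) := :- (:- x :* :- y)) refl _ _ ⟩
    - (- sgn (toℕ j) * - sgn (toℕ b))                   ∎

  det-rows₀₁-equal : ∀ n (M : Matrix (suc (suc n))) → M zero ≋ M (suc zero) → det (suc (suc n)) M ≈ 0#
  det-rows₀₁-equal n M M₀≋M₁ = begin
    det (suc (suc n)) M
      ≈⟨ ∑-cong (λ j → trans (*-congˡ (*-distribˡ-∑ (M zero j) (term j)))
                             (*-distribˡ-∑ (sgn (toℕ j)) (M zero j *ᵥ term j))) ⟩
    ∑ (λ j → ∑ (F j))
      ≈⟨ ∑∑-cancel (suc n) F cancels ⟩
    0# ∎
    where
    D : Fin (suc (suc n)) → Fin (suc n) → Carrier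
    D j b = det n (λ x y → M (suc (suc x)) (punchIn j (punchIn b y)))
    term : Fin (suc (suc n)) → Vector (suc n)
    term j b = sgn (toℕ b) * (M (suc zero) (punchIn j b) * D j b)
    F : Fin (suc (suc n)) → Fin (suc n) → Carrier
    F j b = sgn (toℕ j) * (M zero j * term j b)
    cancels : ∀ j b → F j b + F (punchIn j b) (pinch b j) ≈ 0#
    cancels j b = begin
      F j b + F j′ b′
        ≈⟨ +-cong (*-congˡ (*-congˡ (*-congˡ (*-congʳ (sym (M₀≋M₁ j′))))))
                  (*-congˡ (*-congˡ (*-congˡ (*-cong row₁ minor≈)))) ⟩
      sgn (toℕ j) * (M zero j * (sgn (toℕ b) * (M zero j′ * D j b)))
        + sgn (toℕ j′) * (M zero j′ * (sgn (toℕ b′) * (M zero j * D j b)))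
        ≈⟨ solve 7 (λ s t s′ t′ m m′ d → s :* (m :* (t :* (m′ :* d))) :+ s′ :* (m′ :* (t′ :* (m :* d)))
                                       := (s :* t :+ s′ :* t′) :* (m :* (m′ :* d)))
                   refl (sgn (toℕ j)) (sgn (toℕ b)) (sgn (toℕ j′)) (sgn (toℕ b′)) (M zero j) (M zero j′) (D j b) ⟩
      (sgn (toℕ j) * sgn (toℕ b) + sgn (toℕ j′) * sgn (toℕ b′)) * (M zero j * (M zero j′ * D j b))
        ≈⟨ *-congʳ (trans (+-congˡ (sgn-punchIn-pinch j b)) (-‿inverseʳ _)) ⟩
      0# * (M zero j * (M zero j′ * D j b))
        ≈⟨ zeroˡ _ ⟩
      0# ∎
      where
      j′ = punchIn j b
      b′ = pinch b j
      row₁ : M (suc zero) (punchIn j′ b′) ≈ M zero j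
      row₁ = trans (reflexive (≡.cong (M (suc zero)) (punchIn-punchIn-pinch j b))) (sym (M₀≋M₁ j))
      minor≈ : D j′ b′ ≈ D j b
      minor≈ = det-cong n (λ x y → reflexive (≡.cong (M (suc (suc x))) (punchIn-punchIn-pinch-comm j b y)))

  det-add-row₁-to-row₀ : ∀ n {P M : Matrix (suc (suc n))} x →
    P zero ≋ M zero +ᵥ x *ᵥ M (suc zero) → (∀ i → P (suc i) ≋ M (suc i)) →
    det (suc (suc n)) P ≈ det (suc (suc n)) M
  det-add-row₁-to-row₀ n {P} {M} x row₀ P≋M = begin
    det (suc (suc n)) P                ≈⟨ det-linear-row₀ (suc n) {P} {M} {M₁M} x row₀ P≋M (λ i k → refl) ⟩
    det (suc (suc n)) M + x * det (suc (suc n)) M₁M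
                                       ≈⟨ +-congˡ (*-congˡ (det-rows₀₁-equal n M₁M (λ k → refl))) ⟩
    det (suc (suc n)) M + x * 0#       ≈⟨ +-congˡ (zeroʳ x) ⟩
    det (suc (suc n)) M + 0#           ≈⟨ +-identityʳ _ ⟩
    det (suc (suc n)) M                ∎
    where M₁M = setRow₀ (M (suc zero)) M

  det-swap-rows₀₁ : ∀ n {Q M : Matrix (suc (suc n))} →
    Q zero ≋ M (suc zero) → Q (suc zero) ≋ M zero → (∀ i → Q (suc (suc i)) ≋ M (suc (suc i))) →
    det (suc (suc n)) Q ≈ - det (suc (suc n)) M
  det-swap-rows₀₁ n {Q} {M} Q₀ Q₁ Q≋M = begin
    det (suc (suc n)) Q   ≈⟨ det-cong (suc (suc n)) Q≋M₁₀ ⟩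
    f b a                 ≈⟨ +-inverseʳ-unique (f a b) (f b a) antisymmetric ⟩
    - f a b               ≈⟨ -‿cong (det-cong (suc (suc n)) M₀₁≋M) ⟩
    - det (suc (suc n)) M ∎
    where
    a = M zero
    b = M (suc zero)
    f : Vector (suc (suc n)) → Vector (suc (suc n)) → Carrier
    f u v = det (suc (suc n)) (setRows₀₁ u v M)
    Q≋M₁₀ : ∀ i → Q i ≋ setRows₀₁ b a M i
    Q≋M₁₀ zero          = Q₀
    Q≋M₁₀ (suc zero)    = Q₁
    Q≋M₁₀ (suc (suc i)) = Q≋M i
    M₀₁≋M : ∀ i → setRows₀₁ a b M i ≋ M i
    M₀₁≋M zero          k = refl
    M₀₁≋M (suc zero)    k = refl
    M₀₁≋M (suc (suc i)) k = refl
    alternating : ∀ u → f u u ≈ 0#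
    alternating u = det-rows₀₁-equal n (setRows₀₁ u u M) (λ k → refl)
    additiveˡ : ∀ u v w → f (u +ᵥ v) w ≈ f u w + f v w
    additiveˡ u v w = trans
      (det-linear-row₀ (suc n) {setRows₀₁ (u +ᵥ v) w M} {setRows₀₁ u w M} {setRows₀₁ v w M} 1#
        (λ k → +-congˡ (sym (*-identityˡ _))) lower lower)
      (+-congˡ (*-identityˡ _))
      where
      lower : ∀ {u′ u″} i → setRows₀₁ u′ w M (suc i) ≋ setRows₀₁ u″ w M (suc i)
      lower zero    k = refl
      lower (suc i) k = refl
    additiveʳ : ∀ u v w → f u (v +ᵥ w) ≈ f u v + f u w
    additiveʳ u v w = trans
      (det-linear-row₁ n {setRows₀₁ u (v +ᵥ w) M} {setRows₀₁ u v M} {setRows₀₁ u w M} 1#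
        (λ k → refl) (λ k → refl) (λ k → +-congˡ (sym (*-identityˡ _))) (λ i k → refl) (λ i k → refl))
      (+-congˡ (*-identityˡ _))
    antisymmetric : f a b + f b a ≈ 0#
    antisymmetric = begin
      f a b + f b a                     ≈⟨ solve 2 (λ x y → x :+ y := (𝟘 :+ x) :+ (y :+ 𝟘)) refl _ _ ⟩
      (0# + f a b) + (f b a + 0#)       ≈⟨ +-cong (+-congʳ (alternating a)) (+-congˡ (alternating b)) ⟨
      (f a a + f a b) + (f b a + f b b) ≈⟨ +-cong (additiveʳ a a b) (additiveʳ b a b) ⟨
      f a (a +ᵥ b) + f b (a +ᵥ b)       ≈⟨ additiveˡ a b (a +ᵥ b) ⟨
      f (a +ᵥ b) (a +ᵥ b)               ≈⟨ alternating (a +ᵥ b) ⟩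
      0#                                ∎

  -- Swapping rows 0 and 1 turns this into adding multiples of row 1, which the Laplace
  -- expansion passes to the minors as adding multiples of their row 0.
  det-add-row₀-multiples : ∀ n {N M : Matrix (suc n)} (d : Vector n) →
    N zero ≋ M zero → (∀ i → N (suc i) ≋ M (suc i) +ᵥ d i *ᵥ M zero) →
    det (suc n) N ≈ det (suc n) M
  det-add-row₁-multiples : ∀ n {N M : Matrix (suc (suc n))} (d : Vector n) →
    N zero ≋ M zero → N (suc zero) ≋ M (suc zero) →
    (∀ i → N (suc (suc i)) ≋ M (suc (suc i)) +ᵥ d i *ᵥ M (suc zero)) →
    det (suc (suc n)) N ≈ det (suc (suc n)) M

  det-add-row₀-multiples zero {N} {M} d N₀ N≋ = det-cong 1 {N} {M} λ { zero → N₀ }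
  det-add-row₀-multiples (suc n) {N} {M} d N₀ N≋ = begin
    det (suc (suc n)) N    ≈⟨ det-swap-rows₀₁ n {N} {N′} (λ k → refl) (λ k → refl) (λ i k → refl) ⟩
    - det (suc (suc n)) N′ ≈⟨ -‿cong (det-add-row₁-multiples n {N′} {N″} (λ i → d (suc i))
                                 (λ k → refl) N₀ (λ i → N≋ (suc i))) ⟩
    - det (suc (suc n)) N″ ≈⟨ -‿cong (det-add-row₁-to-row₀ n {N″} {M′} (d zero) (N≋ zero) lower) ⟩
    - det (suc (suc n)) M′ ≈⟨ -‿cong (det-swap-rows₀₁ n {M′} {M} (λ k → refl) (λ k → refl) (λ i k → refl)) ⟩
    - - det (suc (suc n)) M ≈⟨ -‿involutive _ ⟩
    det (suc (suc n)) M    ∎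
    where
    N′ = setRows₀₁ (N (suc zero)) (N zero) N
    N″ = setRows₀₁ (N (suc zero)) (M zero) M
    M′ = setRows₀₁ (M (suc zero)) (M zero) M
    lower : ∀ i → N″ (suc i) ≋ M′ (suc i)
    lower zero    k = refl
    lower (suc i) k = refl

  det-add-row₁-multiples n {N} {M} d N₀ N₁ N≋ = det-expansion-cong (suc n) {N} {M} N₀
    (λ j → det-add-row₀-multiples n {minor N j} {minor M j} d (λ k → N₁ (punchIn j k)) (λ i k → N≋ i (punchIn j k)))

  det-add-row₀-to-row₁ : ∀ n {N M : Matrix (suc (suc n))} x →
    N zero ≋ M zero → N (suc zero) ≋ M (suc zero) +ᵥ x *ᵥ M zero →
    (∀ i → N (suc (suc i)) ≋ M (suc (suc i))) → det (suc (suc n)) N ≈ det (suc (suc n)) M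
  det-add-row₀-to-row₁ n {N} {M} x N₀ N₁ N≋ = det-add-row₀-multiples (suc n) {N} {M} d N₀ N≋′
    where
    d : Vector (suc n)
    d zero    = x
    d (suc i) = 0#
    N≋′ : ∀ i → N (suc i) ≋ M (suc i) +ᵥ d i *ᵥ M zero
    N≋′ zero    = N₁
    N≋′ (suc i) k = trans (N≋ i k) (solve 2 (λ a b → a := a :+ 𝟘 :* b) refl _ _)

  det-add-previous-rows : ∀ n {N M : Matrix (suc n)} (c : Vector n) →
    N zero ≋ M zero → (∀ i → N (suc i) ≋ M (suc i) +ᵥ c i *ᵥ M (inject₁ i)) →
    det (suc n) N ≈ det (suc n) M
  det-add-previous-rows zero    {N} {M} c N₀ N≋ = det-cong 1 {N} {M} λ { zero → N₀ }
  det-add-previous-rows (suc n) {N} {M} c N₀ N≋ = begin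
    det (suc (suc n)) N  ≈⟨ det-add-row₀-to-row₁ n {N} {N′} (c zero) (λ k → refl) N₁ (λ i k → refl) ⟩
    det (suc (suc n)) N′ ≈⟨ det-expansion-cong (suc n) {N′} {M} N₀ (λ j →
                             det-add-previous-rows n {minor N′ j} {minor M j} (λ i → c (suc i))
                               (λ k → refl) (λ i k → N≋ (suc i) (punchIn j k))) ⟩
    det (suc (suc n)) M  ∎
    where
    N′ = setRows₀₁ (N zero) (M (suc zero)) N
    N₁ : N (suc zero) ≋ M (suc zero) +ᵥ c zero *ᵥ N zero
    N₁ k = trans (N≋ zero k) (+-congˡ (*-congˡ (sym (N₀ k))))

  *-*-zeroˡ : ∀ s {m} d → m ≈ 0# → s * (m * d) ≈ 0#
  *-*-zeroˡ s d m≈0 = trans (*-congˡ (trans (*-congʳ m≈0) (zeroˡ d))) (zeroʳ s)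

  *-*-zeroʳ : ∀ s m {d} → d ≈ 0# → s * (m * d) ≈ 0#
  *-*-zeroʳ s m d≈0 = trans (*-congˡ (trans (*-congˡ d≈0) (zeroʳ m))) (zeroʳ s)

  det-zero-column₀ : ∀ n (M : Matrix (suc n)) → (∀ i → M i zero ≈ 0#) → det (suc n) M ≈ 0#
  det-zero-column₀ zero    M M·₀≈0 = trans (+-identityʳ _) (*-*-zeroˡ 1# 1# (M·₀≈0 zero))
  det-zero-column₀ (suc n) M M·₀≈0 = ∑-zero term≈0
    where
    term≈0 : ∀ j → sgn (toℕ j) * (M zero j * det (suc n) (minor M j)) ≈ 0#
    term≈0 zero    = *-*-zeroˡ 1# _ (M·₀≈0 zero)
    term≈0 (suc j) = *-*-zeroʳ (sgn (toℕ (suc j))) (M zero (suc j))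
                       (det-zero-column₀ n (minor M (suc j)) (λ i → M·₀≈0 (suc i)))

  det-expand-column₀ : ∀ n (M : Matrix (suc n)) → (∀ i → M (suc i) zero ≈ 0#) →
    det (suc n) M ≈ M zero zero * det n (minor M zero)
  det-expand-column₀ zero    M M·₀≈0 = trans (+-identityʳ _) (*-identityˡ _)
  det-expand-column₀ (suc n) M M·₀≈0 = begin
    sgn 0 * (M zero zero * det (suc n) (minor M zero)) + ∑ (λ j → term (suc j))
      ≈⟨ +-congˡ (∑-zero (λ j → *-*-zeroʳ (sgn (toℕ (suc j))) (M zero (suc j))
                                   (det-zero-column₀ n (minor M (suc j)) M·₀≈0))) ⟩
    1# * (M zero zero * det (suc n) (minor M zero)) + 0#
      ≈⟨ trans (+-identityʳ _) (*-identityˡ _) ⟩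
    M zero zero * det (suc n) (minor M zero) ∎
    where
    term : Vector (suc (suc n))
    term j = sgn (toℕ j) * (M zero j * det (suc n) (minor M j))

  det-scale : ∀ n x {N M : Matrix n} → (∀ i → N i ≋ x *ᵥ M i) → det n N ≈ x ^ n * det n M
  det-scale zero    x N≋ = sym (*-identityʳ 1#)
  det-scale (suc n) x {N} {M} N≋ = begin
    det (suc n) N
      ≈⟨ ∑-cong (λ j → term-cong j (N≋ zero j) (det-scale n x (λ i k → N≋ (suc i) (punchIn j k)))) ⟩
    ∑ (λ j → sgn (toℕ j) * ((x * M zero j) * (x ^ n * det n (minor M j))))
      ≈⟨ ∑-cong (λ j → solve 5 (λ s x m y d → s :* ((x :* m) :* (y :* d)) := (x :* y) :* (s :* (m :* d)))
                          refl (sgn (toℕ j)) x (M zero j) (x ^ n) (det n (minor M j))) ⟩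
    ∑ ((x * x ^ n) *ᵥ term)
      ≈⟨ *-distribˡ-∑ (x * x ^ n) term ⟨
    x ^ suc n * det (suc n) M ∎
    where
    term : Vector (suc n)
    term j = sgn (toℕ j) * (M zero j * det n (minor M j))

  det-scale-lower-rows : ∀ n x {N M : Matrix (suc n)} → N zero ≋ M zero →
    (∀ i → N (suc i) ≋ x *ᵥ M (suc i)) → det (suc n) N ≈ x ^ n * det (suc n) M
  det-scale-lower-rows n x {N} {M} N₀ N≋ = begin
    det (suc n) N
      ≈⟨ ∑-cong (λ j → term-cong j (N₀ j) (det-scale n x (λ i k → N≋ i (punchIn j k)))) ⟩
    ∑ (λ j → sgn (toℕ j) * (M zero j * (x ^ n * det n (minor M j))))
      ≈⟨ ∑-cong (λ j → solve 4 (λ s m y d → s :* (m :* (y :* d)) := y :* (s :* (m :* d)))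
                          refl (sgn (toℕ j)) (M zero j) (x ^ n) (det n (minor M j))) ⟩
    ∑ (x ^ n *ᵥ term)
      ≈⟨ *-distribˡ-∑ (x ^ n) term ⟨
    x ^ n * det (suc n) M ∎
    where
    term : Vector (suc n)
    term j = sgn (toℕ j) * (M zero j * det n (minor M j))

  det-add-constant : ∀ n (P : Matrix (suc n)) t →
    det (suc n) (λ j k → P j k + t)
      ≈ det (suc n) P + t * det n (λ j k → P (suc j) (suc k) - P (suc j) zero - P zero (suc k) + P zero zero)
  det-add-constant n P t = begin
    det (suc n) P+t
      ≈⟨ det-add-row₀-multiples n {P+t} {Q} (λ _ → 1#) (λ k → refl)
           (λ i k → solve 3 (λ p p₀ t → p :+ t := (p :- p₀) :+ 𝟙 :* (p₀ :+ t)) refl _ _ t) ⟩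
    det (suc n) Q
      ≈⟨ det-linear-row₀ n {Q} {setRow₀ (P zero) Q} {setRow₀ (λ _ → 1#) Q} t
           (λ k → +-congˡ (sym (*-identityʳ t))) (λ i k → refl) (λ i k → refl) ⟩
    det (suc n) (setRow₀ (P zero) Q) + t * det (suc n) (setRow₀ (λ _ → 1#) Q)
      ≈⟨ +-cong (det-add-row₀-multiples n {P} {setRow₀ (P zero) Q} (λ _ → 1#) (λ k → refl)
                  (λ i k → solve 2 (λ p p₀ → p := (p :- p₀) :+ 𝟙 :* p₀) refl _ _))
                (*-congˡ (det-add-row₀-multiples n {K} {setRow₀ (λ _ → 1#) Q}
                  (λ i → P zero zero - P (suc i) zero) (λ k → refl)
                  (λ i k → solve 4 (λ p p₀ pᵢ p₀₀ → p :- pᵢ :- p₀ :+ p₀₀ := (p :- p₀) :+ (p₀₀ :- pᵢ) :* 𝟙)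
                             refl _ _ _ _))) ⟨
    det (suc n) P + t * det (suc n) K
      ≈⟨ +-congˡ (*-congˡ (det-expand-column₀ n K (λ i → solve 2 (λ pᵢ p₀₀ → pᵢ :- pᵢ :- p₀₀ :+ p₀₀ := 𝟘) refl _ _))) ⟩
    det (suc n) P + t * (1# * det n (minor K zero))
      ≈⟨ +-congˡ (*-congˡ (*-identityˡ _)) ⟩
    det (suc n) P + t * det n (minor K zero) ∎
    where
    P+t Q K : Matrix (suc n)
    P+t j k = P j k + t
    Q zero    k = P zero k + t
    Q (suc i) k = P (suc i) k - P zero k
    K zero    k = 1#
    K (suc i) k = P (suc i) k - P (suc i) zero - P zero k + P zero zero

module KacMurdockSzegő {c ℓ : Level} (R : CommutativeRing c ℓ) (q : CommutativeRing.Carrier R) where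
  open CommutativeRing R hiding (zero)
  open RS (Algebra.Bundles.Semiring.rawSemiring semiring) using (_^_) renaming (_×_ to _·_)
  open import Algebra.Properties.Ring ring using (-‿distribˡ-*)
  open Determinant R
  open DeterminantProperties R
  open IntegerCoefficients R
  open SetoidReasoning setoid

  -- firstDiff a k is -q^(a-k) for k ≤ a and q^(k-a-1) for k > a;
  -- secondDiff a b is 0 for b < a, -1 for b = a and (1 - q) q^(b-a-1) for b > a.
  firstDiff : ℕ → ℕ → Carrier
  firstDiff zero    zero    = - 1#
  firstDiff zero    (suc b) = q ^ b
  firstDiff (suc a) zero    = - q ^ suc a
  firstDiff (suc a) (suc b) = firstDiff a b

  secondDiff : ℕ → ℕ → Carrier
  secondDiff zero    zero    = - 1#
  secondDiff zero    (suc b) = (1# - q) * q ^ b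
  secondDiff (suc a) zero    = 0#
  secondDiff (suc a) (suc b) = secondDiff a b

  firstDiff-zeroʳ : ∀ a → firstDiff a zero ≈ - q ^ a
  firstDiff-zeroʳ zero    = refl
  firstDiff-zeroʳ (suc a) = refl

  q^∣-∣-difference : ∀ a k → q ^ ∣ suc a - k ∣ - q ^ ∣ a - k ∣ ≈ (1# - q) * firstDiff a k
  q^∣-∣-difference zero    zero    = solve 1 (λ q → q :* 𝟙 :- 𝟙 := (𝟙 :- q) :* (:- 𝟙)) refl q
  q^∣-∣-difference zero    (suc b) = solve 2 (λ q Q → Q :- q :* Q := (𝟙 :- q) :* Q) refl q (q ^ b)
  q^∣-∣-difference (suc a) zero    = solve 2 (λ q Q → q :* (q :* Q) :- q :* Q := (𝟙 :- q) :* (:- (q :* Q))) refl q (q ^ a)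
  q^∣-∣-difference (suc a) (suc b) = q^∣-∣-difference a b

  firstDiff-difference : ∀ a b → firstDiff a b - q * firstDiff a (suc b) ≈ (1# + q) * secondDiff a b
  firstDiff-difference zero    zero    = solve 1 (λ q → :- 𝟙 :- q :* 𝟙 := (𝟙 :+ q) :* (:- 𝟙)) refl q
  firstDiff-difference zero    (suc b) = solve 2 (λ q Q → Q :- q :* (q :* Q) := (𝟙 :+ q) :* ((𝟙 :- q) :* Q)) refl q (q ^ b)
  firstDiff-difference (suc a) zero    = trans (+-congˡ (-‿cong (*-congˡ (firstDiff-zeroʳ a))))
    (solve 2 (λ q Q → :- (q :* Q) :- q :* (:- Q) := (𝟙 :+ q) :* 𝟘) refl q (q ^ a))
  firstDiff-difference (suc a) (suc b) = firstDiff-difference a b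

  firstDiffMatrix : ∀ {n} → (ℕ → Carrier) → Matrix n
  firstDiffMatrix u zero    k = u (toℕ k)
  firstDiffMatrix u (suc a) k = firstDiff (toℕ a) (toℕ k)

  secondDiffMatrix : ∀ {n} → (ℕ → Carrier) → Matrix n
  secondDiffMatrix f zero    k = f (toℕ k)
  secondDiffMatrix f (suc a) k = secondDiff (toℕ a) (toℕ k)

  det-secondDiffMatrix-cong : ∀ n {f g : ℕ → Carrier} → (∀ b → f b ≈ g b) →
    det n (secondDiffMatrix f) ≈ det n (secondDiffMatrix g)
  det-secondDiffMatrix-cong n f≈g = det-cong n λ { zero k → f≈g (toℕ k) ; (suc i) k → refl }

  det-secondDiffMatrix : ∀ m x y →
    det (suc m) (secondDiffMatrix (λ b → x + y * q ^ b)) ≈ x + y + m · (x * (1# - q))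
  det-secondDiffMatrix zero    x y =
    solve 2 (λ x y → 𝟙 :* ((x :+ y :* 𝟙) :* 𝟙) :+ 𝟘 := x :+ y :+ 𝟘) refl x y
  det-secondDiffMatrix (suc m) x y = begin
    det (suc (suc m)) M    ≈⟨ det-add-row₁-to-row₀ m {M′} {M} f₀ (λ k → refl) (λ i k → refl) ⟨
    det (suc (suc m)) M′   ≈⟨ det-swap-rows₀₁ m {M′} {M″} (λ k → refl) (λ k → refl) (λ i k → refl) ⟩
    - det (suc (suc m)) M″ ≈⟨ -‿cong (det-expand-column₀ (suc m) M″ M″·₀≈0) ⟩
    - (- 1# * det (suc m) (minor M″ zero))
      ≈⟨ -‿cong (*-congˡ (trans (det-cong (suc m) {minor M″ zero} {secondDiffMatrix (λ b → x + y′ * q ^ b)}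
                                   λ { zero k → row₀ (toℕ k) ; (suc i) k → refl })
                                (det-secondDiffMatrix m x y′))) ⟩
    - (- 1# * (x + y′ + m · (x * (1# - q))))
      ≈⟨ solve 4 (λ x y q z → :- (:- 𝟙 :* (x :+ (y :+ x :* (𝟙 :- q)) :+ z)) := x :+ y :+ (x :* (𝟙 :- q) :+ z))
               refl x y q (m · (x * (1# - q))) ⟩
    x + y + suc m · (x * (1# - q)) ∎
    where
    f : ℕ → Carrier
    f b = x + y * q ^ b
    f₀ = f 0
    y′ = y + x * (1# - q)
    M = secondDiffMatrix {suc (suc m)} f
    M′ = setRow₀ (M zero +ᵥ f₀ *ᵥ M (suc zero)) M
    M″ = setRows₀₁ (M (suc zero)) (M′ zero) M
    M″·₀≈0 : ∀ i → M″ (suc i) zero ≈ 0#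
    M″·₀≈0 zero    = solve 2 (λ x y → (x :+ y :* 𝟙) :+ (x :+ y :* 𝟙) :* (:- 𝟙) := 𝟘) refl x y
    M″·₀≈0 (suc i) = refl
    row₀ : ∀ b → f (suc b) + f₀ * secondDiff 0 (suc b) ≈ x + y′ * q ^ b
    row₀ b = solve 4 (λ x y q Q → (x :+ y :* (q :* Q)) :+ (x :+ y :* 𝟙) :* ((𝟙 :- q) :* Q)
                                   := x :+ (y :+ x :* (𝟙 :- q)) :* Q) refl x y q (q ^ b)

  det-firstDiffMatrix : ∀ m (u : ℕ → Carrier) → u 0 ≈ 1# →
    det (suc (suc m)) (firstDiffMatrix u)
      ≈ (1# + q) ^ m * det (suc m) (secondDiffMatrix (λ b → q ^ b + u (suc b)))
  det-firstDiffMatrix m u u₀≈1 = begin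
    det (suc (suc m)) (firstDiffMatrix u)
      ≈⟨ det-add-previous-rows (suc m) {N} {firstDiffMatrix u} coeff (λ k → refl) N≋ ⟨
    det (suc (suc m)) N
      ≈⟨ det-expand-column₀ (suc m) N N·₀≈0 ⟩
    u 0 * det (suc m) (minor N zero)
      ≈⟨ *-cong u₀≈1 (det-scale-lower-rows m (1# + q)
                        {minor N zero} {secondDiffMatrix (λ b → q ^ b + u (suc b))} (λ k → refl)
                        (λ i k → firstDiff-difference (toℕ i) (toℕ k))) ⟩
    1# * ((1# + q) ^ m * det (suc m) (secondDiffMatrix (λ b → q ^ b + u (suc b))))
      ≈⟨ *-identityˡ _ ⟩
    (1# + q) ^ m * det (suc m) (secondDiffMatrix (λ b → q ^ b + u (suc b))) ∎
    where
    coeff : Vector (suc m)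
    coeff zero    = 1#
    coeff (suc _) = - q
    N : Matrix (suc (suc m))
    N zero          k = u (toℕ k)
    N (suc zero)    k = firstDiff 0 (toℕ k) + u (toℕ k)
    N (suc (suc a)) k = firstDiff (suc (toℕ a)) (toℕ k) - q * firstDiff (toℕ a) (toℕ k)
    N≋ : ∀ i → N (suc i) ≋ firstDiffMatrix u (suc i) +ᵥ coeff i *ᵥ firstDiffMatrix u (inject₁ i)
    N≋ zero    k = +-congˡ (sym (*-identityˡ _))
    N≋ (suc i) k = begin
      firstDiff (suc (toℕ i)) (toℕ k) - q * firstDiff (toℕ i) (toℕ k)
        ≈⟨ +-congˡ (-‿distribˡ-* q _) ⟩
      firstDiff (suc (toℕ i)) (toℕ k) + - q * firstDiff (toℕ i) (toℕ k)
        ≡⟨ ≡.cong (λ a → firstDiff (suc (toℕ i)) (toℕ k) + - q * firstDiff a (toℕ k)) (toℕ-inject₁ i) ⟨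
      firstDiff (suc (toℕ i)) (toℕ k) + - q * firstDiff (toℕ (inject₁ i)) (toℕ k) ∎
    N·₀≈0 : ∀ i → N (suc i) zero ≈ 0#
    N·₀≈0 zero    = trans (+-congˡ u₀≈1) (-‿inverseˡ 1#)
    N·₀≈0 (suc i) = trans (+-congˡ (-‿cong (*-congˡ (firstDiff-zeroʳ (toℕ i)))))
      (solve 2 (λ q Q → :- (q :* Q) :- q :* (:- Q) := 𝟘) refl q (q ^ toℕ i))

  ·-as-* : ∀ n x → n · x ≈ (n · 1#) * x
  ·-as-* n x = trans (×-congʳ n (sym (*-identityˡ x))) (sym (×-assoc-* n 1# x))
    where open import Algebra.Properties.Semiring.Mult semiring using (×-congʳ; ×-assoc-*)

  det-firstDiffMatrix-q^ : ∀ m → det (suc (suc m)) (firstDiffMatrix (q ^_)) ≈ (1# + q) ^ suc m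
  det-firstDiffMatrix-q^ m = begin
    det (suc (suc m)) (firstDiffMatrix (q ^_))
      ≈⟨ det-firstDiffMatrix m (q ^_) refl ⟩
    (1# + q) ^ m * det (suc m) (secondDiffMatrix (λ b → q ^ b + q ^ suc b))
      ≈⟨ *-congˡ (det-secondDiffMatrix-cong (suc m) (λ b →
           solve 2 (λ q Q → Q :+ q :* Q := 𝟘 :+ (𝟙 :+ q) :* Q) refl q (q ^ b))) ⟩
    (1# + q) ^ m * det (suc m) (secondDiffMatrix (λ b → 0# + (1# + q) * q ^ b))
      ≈⟨ *-congˡ (det-secondDiffMatrix m 0# (1# + q)) ⟩
    (1# + q) ^ m * (0# + (1# + q) + m · (0# * (1# - q)))
      ≈⟨ *-congˡ (+-congˡ (·-as-* m _)) ⟩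
    (1# + q) ^ m * (0# + (1# + q) + (m · 1#) * (0# * (1# - q)))
      ≈⟨ solve 3 (λ q b ν → b :* (𝟘 :+ (𝟙 :+ q) :+ ν :* (𝟘 :* (𝟙 :- q))) := (𝟙 :+ q) :* b)
               refl q ((1# + q) ^ m) (m · 1#) ⟩
    (1# + q) ^ suc m ∎

  det-firstDiffMatrix-1 : ∀ m →
    det (suc (suc m)) (firstDiffMatrix (λ _ → 1#)) ≈ (1# + q) ^ m * (1# + 1# + (m · 1#) * (1# - q))
  det-firstDiffMatrix-1 m = begin
    det (suc (suc m)) (firstDiffMatrix (λ _ → 1#))
      ≈⟨ det-firstDiffMatrix m (λ _ → 1#) refl ⟩
    (1# + q) ^ m * det (suc m) (secondDiffMatrix (λ b → q ^ b + 1#))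
      ≈⟨ *-congˡ (det-secondDiffMatrix-cong (suc m) (λ b →
           trans (+-comm (q ^ b) 1#) (+-congˡ (sym (*-identityˡ (q ^ b)))))) ⟩
    (1# + q) ^ m * det (suc m) (secondDiffMatrix (λ b → 1# + 1# * q ^ b))
      ≈⟨ *-congˡ (det-secondDiffMatrix m 1# 1#) ⟩
    (1# + q) ^ m * (1# + 1# + m · (1# * (1# - q)))
      ≈⟨ *-congˡ (+-congˡ (trans (·-as-* m _) (*-congˡ (*-identityˡ _)))) ⟩
    (1# + q) ^ m * (1# + 1# + (m · 1#) * (1# - q)) ∎

  kms : ∀ {n} → Matrix n
  kms j k = q ^ ∣ toℕ j - toℕ k ∣

  det-kms+constant-linear : ∀ m t →
    det (suc (suc m)) (λ j k → kms j k + t)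
      ≈ (1# - q) ^ suc m * (1# + q) ^ suc m
        + t * ((1# - q) ^ suc m * ((1# + q) ^ m * (1# + 1# + (m · 1#) * (1# - q))))
  det-kms+constant-linear m t = begin
    det (suc (suc m)) (λ j k → kms j k + t)
      ≈⟨ det-add-previous-rows (suc m) {A} {λ j k → kms j k + t} (λ _ → - 1#) (λ k → refl) A≋ ⟨
    det (suc (suc m)) A
      ≈⟨ det-linear-row₀ (suc m) {A} {setRow₀ ((q ^_) ∘ toℕ) A} {setRow₀ (λ _ → 1#) A} t
           (λ k → +-congˡ (sym (*-identityʳ t))) (λ i k → refl) (λ i k → refl) ⟩
    det (suc (suc m)) (setRow₀ ((q ^_) ∘ toℕ) A) + t * det (suc (suc m)) (setRow₀ (λ _ → 1#) A)
      ≈⟨ +-cong (scaled (q ^_)) (*-congˡ (scaled (λ _ → 1#))) ⟩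
    (1# - q) ^ suc m * det (suc (suc m)) (firstDiffMatrix (q ^_))
      + t * ((1# - q) ^ suc m * det (suc (suc m)) (firstDiffMatrix (λ _ → 1#)))
      ≈⟨ +-cong (*-congˡ (det-firstDiffMatrix-q^ m)) (*-congˡ (*-congˡ (det-firstDiffMatrix-1 m))) ⟩
    (1# - q) ^ suc m * (1# + q) ^ suc m
      + t * ((1# - q) ^ suc m * ((1# + q) ^ m * (1# + 1# + (m · 1#) * (1# - q)))) ∎
    where
    A : Matrix (suc (suc m))
    A zero    k = q ^ toℕ k + t
    A (suc i) k = (1# - q) * firstDiff (toℕ i) (toℕ k)
    A≋ : ∀ i → A (suc i) ≋ (λ k → kms (suc i) k + t) +ᵥ - 1# *ᵥ (λ k → kms (inject₁ i) k + t)
    A≋ i k = begin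
      (1# - q) * firstDiff (toℕ i) (toℕ k)
        ≈⟨ q^∣-∣-difference (toℕ i) (toℕ k) ⟨
      q ^ ∣ suc (toℕ i) - toℕ k ∣ - q ^ ∣ toℕ i - toℕ k ∣
        ≈⟨ solve 3 (λ x y t → x :- y := (x :+ t) :+ :- 𝟙 :* (y :+ t)) refl _ _ t ⟩
      (q ^ ∣ suc (toℕ i) - toℕ k ∣ + t) + - 1# * (q ^ ∣ toℕ i - toℕ k ∣ + t)
        ≡⟨ ≡.cong (λ a → (q ^ ∣ suc (toℕ i) - toℕ k ∣ + t) + - 1# * (q ^ ∣ a - toℕ k ∣ + t)) (toℕ-inject₁ i) ⟨
      (kms (suc i) k + t) + - 1# * (kms (inject₁ i) k + t) ∎
    scaled : ∀ u → det (suc (suc m)) (setRow₀ (u ∘ toℕ) A)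
                   ≈ (1# - q) ^ suc m * det (suc (suc m)) (firstDiffMatrix u)
    scaled u = det-scale-lower-rows (suc m) (1# - q) {setRow₀ (u ∘ toℕ) A} {firstDiffMatrix u}
                 (λ k → refl) (λ i k → refl)

  det-kms+constant : ∀ m t →
    det (suc (suc m)) (λ j k → kms j k + t)
      ≈ (1# - q) ^ suc m * ((1# + q) ^ m * ((suc (suc m) · (1# - q) + 2 · q) * t + q + 1#))
  det-kms+constant m t = begin
    det (suc (suc m)) (λ j k → kms j k + t)
      ≈⟨ det-kms+constant-linear m t ⟩
    (1# - q) ^ suc m * (1# + q) ^ suc m
      + t * ((1# - q) ^ suc m * ((1# + q) ^ m * (1# + 1# + (m · 1#) * (1# - q))))
      ≈⟨ solve 5 (λ q t ν a b →
                   a :* ((𝟙 :+ q) :* b) :+ t :* (a :* (b :* (𝟙 :+ 𝟙 :+ ν :* (𝟙 :- q))))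
                := a :* (b :* ((((𝟙 :- q) :+ ((𝟙 :- q) :+ ν :* (𝟙 :- q))) :+ (q :+ (q :+ 𝟘))) :* t :+ q :+ 𝟙)))
               refl q t (m · 1#) ((1# - q) ^ suc m) ((1# + q) ^ m) ⟩
    (1# - q) ^ suc m * ((1# + q) ^ m * (((1# - q) + ((1# - q) + (m · 1#) * (1# - q)) + 2 · q) * t + q + 1#))
      ≈⟨ *-congˡ (*-congˡ (+-congʳ (+-congʳ (*-congʳ (+-congʳ (+-congˡ (+-congˡ (·-as-* m (1# - q))))))))) ⟨
    (1# - q) ^ suc m * ((1# + q) ^ m * ((suc (suc m) · (1# - q) + 2 · q) * t + q + 1#)) ∎

  linear-coefficient-unique : ∀ {a b c d} → (∀ t → a + t * b ≈ c + t * d) → b ≈ d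
  linear-coefficient-unique {a} {b} {c} {d} same = begin
    b                                  ≈⟨ solve 2 (λ a b → b := (a :+ 𝟙 :* b) :- (a :+ 𝟘 :* b)) refl a b ⟩
    (a + 1# * b) - (a + 0# * b)        ≈⟨ +-cong (same 1#) (-‿cong (same 0#)) ⟩
    (c + 1# * d) - (c + 0# * d)        ≈⟨ solve 2 (λ c d → (c :+ 𝟙 :* d) :- (c :+ 𝟘 :* d) := d) refl c d ⟩
    d                                  ∎

  det-kms-reduced : ∀ m →
    det (suc m) (λ j k → q ^ ∣ suc (toℕ j) - suc (toℕ k) ∣ - q ^ suc (toℕ j) - q ^ suc (toℕ k) + 1#)
      ≈ (1# - q * q) ^ suc m + suc m · ((1# + q) ^ m * (1# - q) ^ suc (suc m))
  det-kms-reduced m = begin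
    det (suc m) (λ j k → q ^ ∣ suc (toℕ j) - suc (toℕ k) ∣ - q ^ suc (toℕ j) - q ^ suc (toℕ k) + 1#)
      ≈⟨ linear-coefficient-unique (λ t →
           trans (sym (det-add-constant (suc m) kms t)) (det-kms+constant-linear m t)) ⟩
    (1# - q) ^ suc m * ((1# + q) ^ m * (1# + 1# + (m · 1#) * (1# - q)))
      ≈⟨ solve 4 (λ q ν a b → a :* (b :* (𝟙 :+ 𝟙 :+ ν :* (𝟙 :- q)))
                              := a :* ((𝟙 :+ q) :* b) :+ (𝟙 :+ ν) :* (b :* ((𝟙 :- q) :* a)))
               refl q (m · 1#) ((1# - q) ^ suc m) ((1# + q) ^ m) ⟩
    (1# - q) ^ suc m * (1# + q) ^ suc m + suc m · 1# * ((1# + q) ^ m * (1# - q) ^ suc (suc m))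
      ≈⟨ +-cong (trans (sym (^-distrib-* (1# - q) (1# + q) (suc m)))
                       (^-congˡ (suc m) (solve 1 (λ q → (𝟙 :- q) :* (𝟙 :+ q) := 𝟙 :- q :* q) refl q)))
                (sym (·-as-* (suc m) _)) ⟩
    (1# - q * q) ^ suc m + suc m · ((1# + q) ^ m * (1# - q) ^ suc (suc m)) ∎
    where open import Algebra.Properties.CommutativeSemiring.Exp commutativeSemiring using (^-distrib-*; ^-congˡ)

corollary1p8 : ∀ {c ℓ : Level} (R : CommutativeRing c ℓ) →
    let open CommutativeRing R
        open RS (Algebra.Bundles.Semiring.rawSemiring semiring) using (_^_) renaming (_×_ to _·_)
        open Determinant R using (det)
    in (q t : Carrier) →
       (∀ (n : ℕ) → 2 ≤ n →
          det n (λ (j k : Fin n) → q ^ ∣ suc (toℕ j) - suc (toℕ k) ∣ + t)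
          ≈ ((1# - q) ^ (n ∸ 1)) * (((1# + q) ^ (n ∸ 2))
              * (((n · (1# - q)) + (2 · q)) * t + q + 1#)))
       ×
       (∀ (n : ℕ) → 1 ≤ n →
          det n (λ (j k : Fin n) →
                   q ^ ∣ suc (toℕ j) - suc (toℕ k) ∣
                   - q ^ suc (toℕ j) - q ^ suc (toℕ k) + 1#)
          ≈ ((1# - q * q) ^ n)
            + n · (((1# + q) ^ (n ∸ 1)) * ((1# - q) ^ suc n)))
corollary1p8 R q t =
    (λ { (suc (suc m)) _ → det-kms+constant m t ; (suc zero) (s≤s ()) })
  , (λ { (suc m) _ → det-kms-reduced m })
  where open KacMurdockSzegő R q
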